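{- In the setting described in the context, there is no $v\in B\setminus(B_1\cup B_2)$ with $w(N(v,A\setminus C))<w(v)$.
   Context: Setting: $\mathcal{S}$ is an instance of the hereditary $3$-set packing problem, i.e., a finite family of nonempty sets of cardinality at most $3$ such that every nonempty subset of a member is a member; $w(s)=|s|-1$, $w(X)=\sum_{s\in X}w(s)$. A feasible solution is a subfamily of pairwise disjoint sets. $N(U,W)=\{x\in W:\exists u\in U:u\cap x\ne\emptyset\}$ and $N(u,W)=N(\{u\},W)$. A family $X\subseteq\mathcal{S}$ of pairwise disjoint sets is a local improvement of a feasible solution $A$ of size $|X|$ if $w(X)>w(N(X,A))$, or $w(X)=w(N(X,A))$ and $X$ contains more sets of weight $2$ than $N(X,A)$. $A$ is a feasible solution with no local improvement of size at most $10$ and $B$ is an optimum feasible solution; $A$ and $B$ consist of sets of cardinality $2$ or $3$. The conflict graph $G$ is the bipartite multigraph on $A\dot\cup B$ with exactly $|a\cap b|$ parallel edges between $a\in A$ and $b\in B$; neighbors and incident edges refer to $G$. $B_1$ is the set of $v\in B$ with exactly one neighbor in $A$; $B_2$ is the set of $v\in B$ with $w(v)=2$ having exactly two incident edges whose endpoints in $A$ are distinct. Step 1: each $v\in B_1$ sends $w(v)$ to its unique neighbor in $A$, and each $v\in B_2$ sends $1$ along each of its two edges. $C$ is the set of $u\in A$ whose total amount received in Step 1 equals exactly $w(u)$. -}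

module Defs where

open import Data.Nat using (ℕ; zero; suc; _+_; _∸_; _≤_; _<_; _≟_; _<?_)
open import Data.Bool using (Bool; true; false; if_then_else_; _∧_)
open import Data.List using (List; []; _∷_; length; map; filter)
open import Data.Nat.ListAction using (sum)
open import Data.List.Membership.Propositional using (_∈_)
open import Data.List.Relation.Unary.All using (All)
open import Data.List.Relation.Unary.Any using (Any; any?)
open import Data.List.Relation.Unary.AllPairs using (AllPairs)
open import Data.List.Relation.Unary.Unique.Propositional using (Unique)
open import Data.Fin.Subset using (Subset; _∩_; ∣_∣; _⊆_; Nonempty; Empty)
open import Data.Product using (_×_)
open import Data.Sum using (_⊎_)
open import Relation.Nullary using (¬_; does; ¬?)
open import Relation.Binary.PropositionalEquality using (_≡_)

w : ∀ {n} → Subset n → ℕ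
w s = ∣ s ∣ ∸ 1

wF : ∀ {n} → List (Subset n) → ℕ
wF X = sum (map w X)

count2 : ∀ {n} → List (Subset n) → ℕ
count2 X = length (filter (λ s → w s ≟ 2) X)

N : ∀ {n} → List (Subset n) → List (Subset n) → List (Subset n)
N U W = filter (λ x → any? (λ u → 0 <? ∣ u ∩ x ∣) U) W

IsInstance : ∀ {n} → List (Subset n) → Set
IsInstance {n} S =
  All (λ s → Nonempty s × ∣ s ∣ ≤ 3) S ×
  (∀ s t → s ∈ S → Nonempty t → t ⊆ s → t ∈ S)

Feasible : ∀ {n} → List (Subset n) → List (Subset n) → Set
Feasible S X = All (_∈ S) X × Unique X × AllPairs (λ a b → Empty (a ∩ b)) X

LocalImprovement : ∀ {n} → List (Subset n) → List (Subset n) → Set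
LocalImprovement A X =
  wF (N X A) < wF X ⊎ (wF X ≡ wF (N X A) × count2 (N X A) < count2 X)

NoLocalImprovement : ∀ {n} → List (Subset n) → ℕ → List (Subset n) → Set
NoLocalImprovement S k A =
  ∀ X → Feasible S X → length X ≤ k → ¬ LocalImprovement A X

Optimum : ∀ {n} → List (Subset n) → List (Subset n) → Set
Optimum S B = Feasible S B × (∀ X → Feasible S X → wF X ≤ wF B)

AllCard23 : ∀ {n} → List (Subset n) → Set
AllCard23 X = All (λ s → ∣ s ∣ ≡ 2 ⊎ ∣ s ∣ ≡ 3) X

nbrs : ∀ {n} → List (Subset n) → Subset n → List (Subset n)
nbrs A v = N (v ∷ []) A

-- number of edges incident to v (|a ∩ v| parallel edges to each a ∈ A)
edges : ∀ {n} → List (Subset n) → Subset n → ℕ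
edges A v = sum (map (λ a → ∣ a ∩ v ∣) A)

InB1 : ∀ {n} → List (Subset n) → Subset n → Set
InB1 A v = length (nbrs A v) ≡ 1

InB2 : ∀ {n} → List (Subset n) → Subset n → Set
InB2 A v = w v ≡ 2 × edges A v ≡ 2 × length (nbrs A v) ≡ 2

inB1? : ∀ {n} → List (Subset n) → Subset n → Bool
inB1? A v = does (length (nbrs A v) ≟ 1)

inB2? : ∀ {n} → List (Subset n) → Subset n → Bool
inB2? A v = does (w v ≟ 2) ∧ does (edges A v ≟ 2) ∧ does (length (nbrs A v) ≟ 2)

recvFrom : ∀ {n} → List (Subset n) → Subset n → Subset n → ℕ
recvFrom A u v =
  (if inB1? A v ∧ does (0 <? ∣ u ∩ v ∣) then w v else 0) +
  (if inB2? A v then ∣ u ∩ v ∣ else 0)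

received : ∀ {n} → List (Subset n) → List (Subset n) → Subset n → ℕ
received A B u = sum (map (recvFrom A u) B)

-- A ∖ C : sets of A that did not receive exactly their weight
AminusC : ∀ {n} → List (Subset n) → List (Subset n) → List (Subset n)
AminusC A B = filter (λ u → ¬? (received A B u ≟ w u)) A

{-# OPTIONS --safe #-}
-- Suppose w(N(v, A∖C)) < w(v). Let Cv be the sets of C meeting v and Rv the sets of A
-- missing v, and trim every b ∈ B to b ∖ ⋃Rv. In Step 1 each b ∈ B sends at most
-- w(trim b) to Cv: if b ∈ B₁ sends anything there, its unique neighbour lies in Cv and
-- trimming removes nothing; if b ∈ B₂, trimming removes at most its edges to Rv, while b
-- has three elements but only two edges. Every set of C receives exactly its weight, so
-- w(Cv) is the total amount sent to Cv. Hence, with F the sets of B sending something to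
-- Cv, the family X = {v} ∪ {trim b : b ∈ F} satisfies
--   w(N(X, A)) ≤ w(N(v, A)) = w(Cv) + w(N(v, A∖C)) < w(Cv) + w(v) ≤ w(X),
-- the first step because trimmed sets avoid Rv. X is feasible (v ∉ F, as v sends nothing)
-- and |X| ≤ 1 + w(Cv) ≤ 1 + 2|v| ≤ 7, so it is a local improvement of size at most 10.
module Submission where

open import Defs
open import Data.Nat using (ℕ; _<_)
open import Data.List using (List; []; _∷_)
open import Data.List.Membership.Propositional using (_∈_)
open import Data.Fin.Subset using (Subset)
open import Relation.Nullary using (¬_)

open import Data.Bool using (true; false; if_then_else_)
open import Data.Bool.Properties using (∧-zeroʳ)
open import Data.Fin using (zero; suc)
open import Data.Vec using ([]; _∷_; here; there)
open import Data.Fin.Subset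
  using (_∩_; _∪_; _─_; ⋃; ∣_∣; _⊆_; Nonempty; Empty; inside; outside)
  renaming (_∈_ to _∈ₛ_; _∉_ to _∉ₛ_)
open import Data.Fin.Subset.Properties
  using (∩-comm; ∩-distribʳ-∪; ∩-zeroˡ; ∣⊥∣≡0; x∈p∩q⁺; x∈p∩q⁻; x∈p∪q⁺; p─q⊆p; drop-∷-Empty)
open import Data.List using (length; map; filter)
open import Data.List.Properties using (map-cong; map-cong-local; map-∘; length-map)
open import Data.List.Membership.Propositional.Properties using (∈-filter⁺; ∈-filter⁻)
open import Data.List.Relation.Binary.Sublist.Propositional
  using ([]; _∷_; _∷ʳ_; ⊆-trans) renaming (_⊆_ to _⊑_)
open import Data.List.Relation.Binary.Sublist.Propositional.Properties
  using (filter-⊆; filter⁺; length-mono-≤)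
open import Data.List.Relation.Unary.All as All using (All; []; _∷_)
open import Data.List.Relation.Unary.All.Properties as All using (all-filter)
open import Data.List.Relation.Unary.AllPairs as AllPairs using (AllPairs; []; _∷_)
import Data.List.Relation.Unary.AllPairs.Properties as AllPairs
open import Data.List.Relation.Unary.Any using (Any; here; there; any?; satisfied)
import Data.List.Relation.Unary.Any.Properties as Any
open import Data.List.Relation.Unary.Unique.Propositional using (Unique)
open import Data.Nat using (suc; _+_; _*_; _≤_; z≤n; s≤s; _≟_; _<?_)
open import Data.Nat.ListAction using (sum)
open import Data.Nat.Properties
open import Algebra.Properties.CommutativeSemigroup +-commutativeSemigroup using (interchange; x∙yz≈y∙xz)
open import Data.Product using (_×_; _,_; proj₁; proj₂)
open import Data.Sum using (inj₁; inj₂)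
open import Function using (id; _∘_)
open import Level using (0ℓ)
open import Relation.Binary.Definitions using (Symmetric)
open import Relation.Binary.PropositionalEquality
open import Relation.Nullary using (Dec; yes; no; does; contradiction; _×-dec_)
open import Relation.Nullary.Decidable using (dec-true; dec-false)
open import Relation.Unary using (Pred; Decidable)
open import Relation.Unary.Properties using (∁?)

private variable
  A C : Set
  n : ℕ
  p q : Subset n

-- Sums over lists

sum-map-≤ : ∀ {f g : A → ℕ} {xs} → All (λ x → f x ≤ g x) xs → sum (map f xs) ≤ sum (map g xs)
sum-map-≤ []         = z≤n
sum-map-≤ (le ∷ les) = +-mono-≤ le (sum-map-≤ les)

sum-map-≤-*length : ∀ {f : A → ℕ} {c xs} → All (λ x → f x ≤ c) xs → sum (map f xs) ≤ c * length xs
sum-map-≤-*length {c = c} []                  = ≤-reflexive (sym (*-zeroʳ c))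
sum-map-≤-*length {c = c} {_ ∷ xs} (le ∷ les) =
  ≤-trans (+-mono-≤ le (sum-map-≤-*length les)) (≤-reflexive (sym (*-suc c (length xs))))

sum-map-zero : ∀ {f : A → ℕ} {xs} → All (λ x → f x ≡ 0) xs → sum (map f xs) ≡ 0
sum-map-zero []       = refl
sum-map-zero (z ∷ zs) = cong₂ _+_ z (sum-map-zero zs)

sum-map-⊑ : ∀ (f : A → ℕ) {xs ys} → xs ⊑ ys → sum (map f xs) ≤ sum (map f ys)
sum-map-⊑ f []              = z≤n
sum-map-⊑ f (y ∷ʳ xs⊑ys)    = ≤-trans (sum-map-⊑ f xs⊑ys) (m≤n+m _ (f y))
sum-map-⊑ f (refl ∷ xs⊑ys)  = +-monoʳ-≤ _ (sum-map-⊑ f xs⊑ys)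

sum-map-+ : ∀ (f g : A → ℕ) xs → sum (map (λ x → f x + g x) xs) ≡ sum (map f xs) + sum (map g xs)
sum-map-+ f g []       = refl
sum-map-+ f g (x ∷ xs) =
  trans (cong (f x + g x +_) (sum-map-+ f g xs)) (interchange (f x) (g x) _ _)

sum-map-comm : ∀ (h : A → C → ℕ) xs ys →
  sum (map (λ x → sum (map (h x) ys)) xs) ≡ sum (map (λ y → sum (map (λ x → h x y) xs)) ys)
sum-map-comm h []       ys = sym (sum-map-zero (All.universal (λ _ → refl) ys))
sum-map-comm h (x ∷ xs) ys = begin
  sum (map (h x) ys) + sum (map (λ x → sum (map (h x) ys)) xs)
    ≡⟨ cong (sum (map (h x) ys) +_) (sum-map-comm h xs ys) ⟩
  sum (map (h x) ys) + sum (map (λ y → sum (map (λ x → h x y) xs)) ys)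
    ≡⟨ sum-map-+ (h x) (λ y → sum (map (λ x → h x y) xs)) ys ⟨
  sum (map (λ y → h x y + sum (map (λ x → h x y) xs)) ys) ∎
  where open ≡-Reasoning

module _ {P : Pred A 0ℓ} (P? : Decidable P) where

  sum-map-filter-split : ∀ (f : A → ℕ) xs →
    sum (map f xs) ≡ sum (map f (filter P? xs)) + sum (map f (filter (∁? P?) xs))
  sum-map-filter-split f []       = refl
  sum-map-filter-split f (x ∷ xs) with does (P? x)
  ... | true  = trans (cong (f x +_) (sum-map-filter-split f xs)) (sym (+-assoc (f x) _ _))
  ... | false = trans (cong (f x +_) (sum-map-filter-split f xs))
                      (x∙yz≈y∙xz (f x) (sum (map f (filter P? xs))) (sum (map f (filter (∁? P?) xs))))

  sum-map-if : ∀ c xs → sum (map (λ x → if does (P? x) then c else 0) xs) ≡ c * length (filter P? xs)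
  sum-map-if c []       = sym (*-zeroʳ c)
  sum-map-if c (x ∷ xs) with does (P? x)
  ... | true  = trans (cong (c +_) (sum-map-if c xs)) (sym (*-suc c _))
  ... | false = sum-map-if c xs

  length-filter≤sum-map : ∀ {f : A → ℕ} → (∀ {x} → P x → 1 ≤ f x) → ∀ xs →
    length (filter P? xs) ≤ sum (map f xs)
  length-filter≤sum-map pos []       = z≤n
  length-filter≤sum-map {f} pos (x ∷ xs) with P? x
  ... | yes px = +-mono-≤ (pos px) (length-filter≤sum-map pos xs)
  ... | no  _  = ≤-trans (length-filter≤sum-map pos xs) (m≤n+m _ (f x))

  module _ {Q : Pred A 0ℓ} (Q? : Decidable Q) where

    filter-⊑-filter : ∀ {xs} → All (λ x → P x → Q x) xs → filter P? xs ⊑ filter Q? xs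
    filter-⊑-filter {[]}     []           = []
    filter-⊑-filter {x ∷ xs} (p⇒q ∷ p⇒qs) with P? x | Q? x
    ... | yes px | yes _  = refl ∷ filter-⊑-filter p⇒qs
    ... | yes px | no ¬qx = contradiction (p⇒q px) ¬qx
    ... | no  _  | yes _  = x ∷ʳ filter-⊑-filter p⇒qs
    ... | no  _  | no  _  = filter-⊑-filter p⇒qs

    filter-comm : ∀ xs → filter P? (filter Q? xs) ≡ filter Q? (filter P? xs)
    filter-comm []       = refl
    filter-comm (x ∷ xs) with does (P? x) in px | does (Q? x) in qx
    ... | true  | true  rewrite px | qx = cong (x ∷_) (filter-comm xs)
    ... | true  | false rewrite qx      = filter-comm xs
    ... | false | true  rewrite px      = filter-comm xs
    ... | false | false                 = filter-comm xs

sum-map-filter-pos : ∀ (f : A → ℕ) xs → sum (map f (filter (λ x → 0 <? f x) xs)) ≡ sum (map f xs)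
sum-map-filter-pos f xs = begin
  sum (map f (filter pos? xs))                                       ≡⟨ +-identityʳ _ ⟨
  sum (map f (filter pos? xs)) + 0                                   ≡⟨ cong (sum (map f (filter pos? xs)) +_) rest≡0 ⟨
  sum (map f (filter pos? xs)) + sum (map f (filter (∁? pos?) xs))  ≡⟨ sum-map-filter-split pos? f xs ⟨
  sum (map f xs)                                                     ∎
  where
  open ≡-Reasoning
  pos? : Decidable (λ x → 0 < f x)
  pos? x = 0 <? f x
  rest≡0 : sum (map f (filter (∁? pos?) xs)) ≡ 0
  rest≡0 = sum-map-zero (All.map (n≤0⇒n≡0 ∘ ≮⇒≥) (all-filter (∁? pos?) xs))

AllPairs⇒related : ∀ {R : A → A → Set} {xs x y} → Symmetric R →
  AllPairs R xs → x ∈ xs → y ∈ xs → x ≢ y → R x y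
AllPairs⇒related sym (_  ∷ _)   (here refl) (here refl) x≢y = contradiction refl x≢y
AllPairs⇒related sym (Rx ∷ _)   (here refl) (there y∈) _   = All.lookup Rx y∈
AllPairs⇒related sym (Ry ∷ _)   (there x∈)  (here refl) _   = sym (All.lookup Ry x∈)
AllPairs⇒related sym (_  ∷ Rxs) (there x∈)  (there y∈) x≢y = AllPairs⇒related sym Rxs x∈ y∈ x≢y

∈-length1⇒≡ : ∀ {xs : List A} {x y} → length xs ≡ 1 → x ∈ xs → y ∈ xs → x ≡ y
∈-length1⇒≡ {xs = _ ∷ []} _ (here refl) (here refl) = refl

-- Finite sets

Disjoint : Subset n → Subset n → Set
Disjoint p q = Empty (p ∩ q)

Meets : Subset n → Subset n → Set
Meets p q = 0 < ∣ p ∩ q ∣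

meets? : ∀ (p q : Subset n) → Dec (Meets p q)
meets? p q = 0 <? ∣ p ∩ q ∣

Meets-sym : ∀ (p q : Subset n) → Meets p q → Meets q p
Meets-sym p q = subst (λ r → 0 < ∣ r ∣) (∩-comm p q)

0<∣p∣⇒Nonempty : 0 < ∣ p ∣ → Nonempty p
0<∣p∣⇒Nonempty {p = inside  ∷ p} _   = zero , here
0<∣p∣⇒Nonempty {p = outside ∷ p} pos with x , x∈p ← 0<∣p∣⇒Nonempty pos = suc x , there x∈p

0<w⇒Nonempty : 0 < w p → Nonempty p
0<w⇒Nonempty {p = p} pos = 0<∣p∣⇒Nonempty (≤-trans pos (m∸n≤m ∣ p ∣ 1))

w≡2⇒∣p∣≡3 : w p ≡ 2 → ∣ p ∣ ≡ 3
w≡2⇒∣p∣≡3 {p = p} w≡2 with ∣ p ∣ | w≡2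
... | suc m | m≡2 = cong suc m≡2

Disjoint⇒¬Meets : Disjoint p q → ¬ Meets p q
Disjoint⇒¬Meets p#q = p#q ∘ 0<∣p∣⇒Nonempty

Disjoint⇒≢ : Nonempty p → Disjoint p q → p ≢ q
Disjoint⇒≢ (x , x∈p) p#p refl = p#p (x , x∈p∩q⁺ (x∈p , x∈p))

Disjoint-sym : Disjoint p q → Disjoint q p
Disjoint-sym {p = p} {q} = subst Empty (∩-comm p q)

Disjoint-mono : ∀ {p′ q′ : Subset n} → p′ ⊆ p → q′ ⊆ q → Disjoint p q → Disjoint p′ q′
Disjoint-mono {p′ = p′} {q′} p′⊆p q′⊆q p#q (x , x∈p′∩q′) with x∈p′ , x∈q′ ← x∈p∩q⁻ p′ q′ x∈p′∩q′ =
  p#q (x , x∈p∩q⁺ (p′⊆p x∈p′ , q′⊆q x∈q′))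

Disjoint-Nonempty⇒Unique : ∀ {ps : List (Subset n)} → All Nonempty ps → AllPairs Disjoint ps → Unique ps
Disjoint-Nonempty⇒Unique []           []             = []
Disjoint-Nonempty⇒Unique (p≠∅ ∷ ps≠∅) (p#ps ∷ ps-disj) =
  All.map (Disjoint⇒≢ p≠∅) p#ps ∷ Disjoint-Nonempty⇒Unique ps≠∅ ps-disj

x∈p─q⇒x∉q : ∀ {x} (p q : Subset n) → x ∈ₛ p ─ q → x ∉ₛ q
x∈p─q⇒x∉q (_ ∷ p) (inside ∷ q) () here
x∈p─q⇒x∉q (_ ∷ p) (_      ∷ q) (there x∈p─q) (there x∈q) = x∈p─q⇒x∉q p q x∈p─q x∈q

x∈q∈qs⇒x∈⋃qs : ∀ {x} {q : Subset n} {qs} → x ∈ₛ q → q ∈ qs → x ∈ₛ ⋃ qs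
x∈q∈qs⇒x∈⋃qs x∈q (here refl)  = x∈p∪q⁺ (inj₁ x∈q)
x∈q∈qs⇒x∈⋃qs x∈q (there q∈qs) = x∈p∪q⁺ (inj₂ (x∈q∈qs⇒x∈⋃qs x∈q q∈qs))

p─⋃qs-Disjoint : ∀ {q : Subset n} {qs} p → q ∈ qs → Disjoint (p ─ ⋃ qs) q
p─⋃qs-Disjoint {q = q} {qs} p q∈qs (x , x∈) with x∈p─⋃qs , x∈q ← x∈p∩q⁻ (p ─ ⋃ qs) q x∈ =
  x∈p─q⇒x∉q p (⋃ qs) x∈p─⋃qs (x∈q∈qs⇒x∈⋃qs x∈q q∈qs)

∣p∩q∣+∣p─q∣≡∣p∣ : ∀ (p q : Subset n) → ∣ p ∩ q ∣ + ∣ p ─ q ∣ ≡ ∣ p ∣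
∣p∩q∣+∣p─q∣≡∣p∣ []            []            = refl
∣p∩q∣+∣p─q∣≡∣p∣ (inside  ∷ p) (inside  ∷ q) = cong suc (∣p∩q∣+∣p─q∣≡∣p∣ p q)
∣p∩q∣+∣p─q∣≡∣p∣ (inside  ∷ p) (outside ∷ q) = trans (+-suc _ _) (cong suc (∣p∩q∣+∣p─q∣≡∣p∣ p q))
∣p∩q∣+∣p─q∣≡∣p∣ (outside ∷ p) (inside  ∷ q) = ∣p∩q∣+∣p─q∣≡∣p∣ p q
∣p∩q∣+∣p─q∣≡∣p∣ (outside ∷ p) (outside ∷ q) = ∣p∩q∣+∣p─q∣≡∣p∣ p q

∣p∪q∣≤∣p∣+∣q∣ : ∀ (p q : Subset n) → ∣ p ∪ q ∣ ≤ ∣ p ∣ + ∣ q ∣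
∣p∪q∣≤∣p∣+∣q∣ []            []            = z≤n
∣p∪q∣≤∣p∣+∣q∣ (inside  ∷ p) (inside  ∷ q) =
  s≤s (≤-trans (∣p∪q∣≤∣p∣+∣q∣ p q) (+-monoʳ-≤ ∣ p ∣ (n≤1+n ∣ q ∣)))
∣p∪q∣≤∣p∣+∣q∣ (inside  ∷ p) (outside ∷ q) = s≤s (∣p∪q∣≤∣p∣+∣q∣ p q)
∣p∪q∣≤∣p∣+∣q∣ (outside ∷ p) (inside  ∷ q) =
  ≤-trans (s≤s (∣p∪q∣≤∣p∣+∣q∣ p q)) (≤-reflexive (sym (+-suc ∣ p ∣ ∣ q ∣)))
∣p∪q∣≤∣p∣+∣q∣ (outside ∷ p) (outside ∷ q) = ∣p∪q∣≤∣p∣+∣q∣ p q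

∣⋃qs∩p∣≤Σ∣q∩p∣ : ∀ (qs : List (Subset n)) p → ∣ ⋃ qs ∩ p ∣ ≤ sum (map (λ q → ∣ q ∩ p ∣) qs)
∣⋃qs∩p∣≤Σ∣q∩p∣ {n} []       p = ≤-reflexive (trans (cong ∣_∣ (∩-zeroˡ p)) (∣⊥∣≡0 n))
∣⋃qs∩p∣≤Σ∣q∩p∣     (q ∷ qs) p = begin
  ∣ (q ∪ ⋃ qs) ∩ p ∣        ≡⟨ cong ∣_∣ (∩-distribʳ-∪ p q (⋃ qs)) ⟩
  ∣ q ∩ p ∪ ⋃ qs ∩ p ∣      ≤⟨ ∣p∪q∣≤∣p∣+∣q∣ (q ∩ p) (⋃ qs ∩ p) ⟩
  ∣ q ∩ p ∣ + ∣ ⋃ qs ∩ p ∣  ≤⟨ +-monoʳ-≤ ∣ q ∩ p ∣ (∣⋃qs∩p∣≤Σ∣q∩p∣ qs p) ⟩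
  ∣ q ∩ p ∣ + sum (map (λ q → ∣ q ∩ p ∣) qs) ∎
  where open ≤-Reasoning

∣p∣≤∣p─⋃qs∣+Σ∣q∩p∣ : ∀ (p : Subset n) qs → ∣ p ∣ ≤ ∣ p ─ ⋃ qs ∣ + sum (map (λ q → ∣ q ∩ p ∣) qs)
∣p∣≤∣p─⋃qs∣+Σ∣q∩p∣ p qs = begin
  ∣ p ∣                                ≡⟨ ∣p∩q∣+∣p─q∣≡∣p∣ p (⋃ qs) ⟨
  ∣ p ∩ ⋃ qs ∣ + ∣ p ─ ⋃ qs ∣          ≡⟨ cong (λ r → ∣ r ∣ + ∣ p ─ ⋃ qs ∣) (∩-comm p (⋃ qs)) ⟩
  ∣ ⋃ qs ∩ p ∣ + ∣ p ─ ⋃ qs ∣          ≤⟨ +-monoˡ-≤ ∣ p ─ ⋃ qs ∣ (∣⋃qs∩p∣≤Σ∣q∩p∣ qs p) ⟩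
  sum (map (λ q → ∣ q ∩ p ∣) qs) + ∣ p ─ ⋃ qs ∣ ≡⟨ +-comm _ ∣ p ─ ⋃ qs ∣ ⟩
  ∣ p ─ ⋃ qs ∣ + sum (map (λ q → ∣ q ∩ p ∣) qs) ∎
  where open ≤-Reasoning

∣[p─r]∩q∣≡∣p∩q∣ : ∀ (p r q : Subset n) → Disjoint r q → ∣ (p ─ r) ∩ q ∣ ≡ ∣ p ∩ q ∣
∣[p─r]∩q∣≡∣p∩q∣ []            []            []            _   = refl
∣[p─r]∩q∣≡∣p∩q∣ (_       ∷ p) (inside  ∷ r) (inside  ∷ q) r#q = contradiction (zero , here) r#q
∣[p─r]∩q∣≡∣p∩q∣ (inside  ∷ p) (inside  ∷ r) (outside ∷ q) r#q = ∣[p─r]∩q∣≡∣p∩q∣ p r q (drop-∷-Empty r#q)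
∣[p─r]∩q∣≡∣p∩q∣ (outside ∷ p) (inside  ∷ r) (outside ∷ q) r#q = ∣[p─r]∩q∣≡∣p∩q∣ p r q (drop-∷-Empty r#q)
∣[p─r]∩q∣≡∣p∩q∣ (inside  ∷ p) (outside ∷ r) (inside  ∷ q) r#q =
  cong suc (∣[p─r]∩q∣≡∣p∩q∣ p r q (drop-∷-Empty r#q))
∣[p─r]∩q∣≡∣p∩q∣ (outside ∷ p) (outside ∷ r) (_       ∷ q) r#q = ∣[p─r]∩q∣≡∣p∩q∣ p r q (drop-∷-Empty r#q)
∣[p─r]∩q∣≡∣p∩q∣ (inside  ∷ p) (outside ∷ r) (outside ∷ q) r#q = ∣[p─r]∩q∣≡∣p∩q∣ p r q (drop-∷-Empty r#q)

Σ∣p∩d∣≤∣p∣ : ∀ (ds : List (Subset n)) p → AllPairs Disjoint ds → sum (map (λ d → ∣ p ∩ d ∣) ds) ≤ ∣ p ∣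
Σ∣p∩d∣≤∣p∣ []       p []               = z≤n
Σ∣p∩d∣≤∣p∣ (d ∷ ds) p (d#ds ∷ ds-disj) = begin
  ∣ p ∩ d ∣ + sum (map (λ e → ∣ p ∩ e ∣) ds)       ≡⟨ cong (λ ns → ∣ p ∩ d ∣ + sum ns) (map-cong-local p∩e≡[p─d]∩e) ⟩
  ∣ p ∩ d ∣ + sum (map (λ e → ∣ (p ─ d) ∩ e ∣) ds) ≤⟨ +-monoʳ-≤ ∣ p ∩ d ∣ (Σ∣p∩d∣≤∣p∣ ds (p ─ d) ds-disj) ⟩
  ∣ p ∩ d ∣ + ∣ p ─ d ∣                            ≡⟨ ∣p∩q∣+∣p─q∣≡∣p∣ p d ⟩
  ∣ p ∣                                            ∎
  where
  open ≤-Reasoning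
  p∩e≡[p─d]∩e : All (λ e → ∣ p ∩ e ∣ ≡ ∣ (p ─ d) ∩ e ∣) ds
  p∩e≡[p─d]∩e = All.map (λ {e} d#e → sym (∣[p─r]∩q∣≡∣p∩q∣ p d e d#e)) d#ds

∈-nbrs⁺ : ∀ {A : List (Subset n)} {a b} → a ∈ A → Meets a b → a ∈ nbrs A b
∈-nbrs⁺ {a = a} {b} a∈A a-b =
  ∈-filter⁺ (λ x → any? (λ u → meets? u x) (b ∷ [])) a∈A (here (Meets-sym a b a-b))

InB2? : ∀ (A : List (Subset n)) b → Dec (InB2 A b)
InB2? A b = w b ≟ 2 ×-dec edges A b ≟ 2 ×-dec length (nbrs A b) ≟ 2

module _ (A : List (Subset n)) (b : Subset n) {u : Subset n} where

  recvFrom-B1 : InB1 A b → recvFrom A u b ≡ (if does (meets? u b) then w b else 0)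
  recvFrom-B1 b∈B1
    rewrite dec-true (length (nbrs A b) ≟ 1) b∈B1
          | dec-false (length (nbrs A b) ≟ 2) (λ two → contradiction (trans (sym b∈B1) two) λ ())
          | ∧-zeroʳ (does (edges A b ≟ 2)) | ∧-zeroʳ (does (w b ≟ 2)) = +-identityʳ _

  recvFrom-B2 : InB2 A b → recvFrom A u b ≡ ∣ u ∩ b ∣
  recvFrom-B2 (w≡2 , edges≡2 , nbrs≡2)
    rewrite dec-false (length (nbrs A b) ≟ 1) (λ one → contradiction (trans (sym nbrs≡2) one) λ ())
          | dec-true (w b ≟ 2) w≡2 | dec-true (edges A b ≟ 2) edges≡2
          | dec-true (length (nbrs A b) ≟ 2) nbrs≡2 = refl

  recvFrom-other : ¬ InB1 A b → ¬ InB2 A b → recvFrom A u b ≡ 0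
  recvFrom-other b∉B1 b∉B2
    rewrite dec-false (length (nbrs A b) ≟ 1) b∉B1 | dec-false (InB2? A b) b∉B2 = refl

module Exchange {n} (A B : List (Subset n)) (v : Subset n) where

  -- The predicate by which N (v ∷ []) filters, so that Nv is literally filter meetsV? A.
  MeetsV : Subset n → Set
  MeetsV a = Any (λ u → Meets u a) (v ∷ [])

  meetsV? : Decidable MeetsV
  meetsV? a = any? (λ u → meets? u a) (v ∷ [])

  inC? : Decidable (λ a → received A B a ≡ w a)
  inC? a = received A B a ≟ w a

  Nv Cv Rv : List (Subset n)
  Nv = N (v ∷ []) A
  Cv = filter inC? Nv
  Rv = filter (∁? meetsV?) A

  trim : Subset n → Subset n
  trim b = b ─ ⋃ Rv

  sentToCv : Subset n → ℕ
  sentToCv b = sum (map (λ a → recvFrom A a b) Cv)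

  F : List (Subset n)
  F = filter (λ b → 0 <? sentToCv b) B

  X : List (Subset n)
  X = v ∷ map trim F

  ∈Cv⁻ : ∀ {a} → a ∈ Cv → a ∈ A × MeetsV a
  ∈Cv⁻ a∈Cv = ∈-filter⁻ meetsV? (proj₁ (∈-filter⁻ inC? a∈Cv))

  Cv⊑A : Cv ⊑ A
  Cv⊑A = ⊆-trans (filter-⊆ inC? Nv) (filter-⊆ meetsV? A)

  trim-avoids-Rv : ∀ {b r} → r ∈ Rv → ¬ Meets (trim b) r
  trim-avoids-Rv {b} r∈Rv = Disjoint⇒¬Meets (p─⋃qs-Disjoint b r∈Rv)

  ∣b∣≤∣trim[b]∣ : ∀ {b} → All (λ r → ¬ Meets r b) Rv → ∣ b ∣ ≤ ∣ trim b ∣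
  ∣b∣≤∣trim[b]∣ {b} untouched = begin
    ∣ b ∣                                          ≤⟨ ∣p∣≤∣p─⋃qs∣+Σ∣q∩p∣ b Rv ⟩
    ∣ trim b ∣ + sum (map (λ r → ∣ r ∩ b ∣) Rv)
      ≡⟨ cong (∣ trim b ∣ +_) (sum-map-zero (All.map (n≤0⇒n≡0 ∘ ≮⇒≥) untouched)) ⟩
    ∣ trim b ∣ + 0                                 ≡⟨ +-identityʳ ∣ trim b ∣ ⟩
    ∣ trim b ∣                                     ∎
    where open ≤-Reasoning

  length-Cv∩nbrs≤length-nbrs : ∀ b → length (filter (λ a → meets? a b) Cv) ≤ length (nbrs A b)
  length-Cv∩nbrs≤length-nbrs b =
    length-mono-≤ (filter⁺ _ _ (λ { {a} refl a-b → here (Meets-sym a b a-b) }) Cv⊑A)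

  B1-meeting-Cv⇒∣b∣≤∣trim[b]∣ : ∀ {a b} → InB1 A b → a ∈ Cv → Meets a b → ∣ b ∣ ≤ ∣ trim b ∣
  B1-meeting-Cv⇒∣b∣≤∣trim[b]∣ {a} {b} b∈B1 a∈Cv a-b = ∣b∣≤∣trim[b]∣ (All.tabulate untouched)
    where
    untouched : ∀ {r} → r ∈ Rv → ¬ Meets r b
    untouched r∈Rv r-b with r∈A , r∉Nv ← ∈-filter⁻ (∁? meetsV?) {xs = A} r∈Rv | a∈A , a∈Nv ← ∈Cv⁻ a∈Cv =
      r∉Nv (subst MeetsV (∈-length1⇒≡ b∈B1 (∈-nbrs⁺ a∈A a-b) (∈-nbrs⁺ r∈A r-b)) a∈Nv)

  sentToCv-B1 : ∀ {b} → InB1 A b → sentToCv b ≤ w (trim b)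
  sentToCv-B1 {b} b∈B1 = begin
    sentToCv b                                                  ≡⟨ cong sum (map-cong (λ a → recvFrom-B1 A b {u = a} b∈B1) Cv) ⟩
    sum (map (λ a → if does (meets? a b) then w b else 0) Cv)  ≡⟨ sum-map-if (λ a → meets? a b) (w b) Cv ⟩
    w b * length (filter (λ a → meets? a b) Cv)                 ≤⟨ w[b]*length≤w[trim[b]] ⟩
    w (trim b)                                                  ∎
    where
    open ≤-Reasoning
    w[b]*length≤w[trim[b]] : w b * length (filter (λ a → meets? a b) Cv) ≤ w (trim b)
    w[b]*length≤w[trim[b]] with filter (λ a → meets? a b) Cv in eq | length-Cv∩nbrs≤length-nbrs b
    ... | []     | _      = ≤-trans (≤-reflexive (*-zeroʳ (w b))) z≤n
    ... | a ∷ as | length≤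
          with a∈Cv , a-b ← ∈-filter⁻ (λ a → meets? a b) (subst (a ∈_) (sym eq) (here refl)) = begin
      w b * length (a ∷ as)  ≤⟨ *-monoʳ-≤ (w b) (≤-trans length≤ (≤-reflexive b∈B1)) ⟩
      w b * 1                ≡⟨ *-identityʳ (w b) ⟩
      w b                    ≤⟨ ∸-monoˡ-≤ 1 (B1-meeting-Cv⇒∣b∣≤∣trim[b]∣ b∈B1 a∈Cv a-b) ⟩
      w (trim b)             ∎

  sentToCv-B2 : ∀ {b} → InB2 A b → sentToCv b ≤ w (trim b)
  sentToCv-B2 {b} b∈B2@(w≡2 , edges≡2 , _) = begin
    sentToCv b     ≡⟨ cong sum (map-cong (λ a → recvFrom-B2 A b {u = a} b∈B2) Cv) ⟩
    edgesFrom Cv   ≤⟨ sum-map-⊑ _ (filter-⊆ inC? Nv) ⟩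
    edgesFrom Nv   ≤⟨ ∸-monoˡ-≤ 1 (+-cancelʳ-≤ (edgesFrom Rv) (suc (edgesFrom Nv)) ∣ trim b ∣ edges-bound) ⟩
    w (trim b)     ∎
    where
    open ≤-Reasoning
    edgesFrom : List (Subset n) → ℕ
    edgesFrom as = sum (map (λ a → ∣ a ∩ b ∣) as)
    edges-bound : suc (edgesFrom Nv) + edgesFrom Rv ≤ ∣ trim b ∣ + edgesFrom Rv
    edges-bound = begin
      suc (edgesFrom Nv + edgesFrom Rv)  ≡⟨ cong suc (trans (sym (sum-map-filter-split meetsV? _ A)) edges≡2) ⟩
      3                                  ≡⟨ w≡2⇒∣p∣≡3 {p = b} w≡2 ⟨
      ∣ b ∣                              ≤⟨ ∣p∣≤∣p─⋃qs∣+Σ∣q∩p∣ b Rv ⟩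
      ∣ trim b ∣ + edgesFrom Rv          ∎

  sentToCv-other : ∀ {b} → ¬ InB1 A b → ¬ InB2 A b → sentToCv b ≡ 0
  sentToCv-other {b} b∉B1 b∉B2 =
    sum-map-zero (All.universal (λ a → recvFrom-other A b {u = a} b∉B1 b∉B2) Cv)

  sentToCv≤w-trim : ∀ b → sentToCv b ≤ w (trim b)
  sentToCv≤w-trim b with length (nbrs A b) ≟ 1 | InB2? A b
  ... | yes b∈B1 | _        = sentToCv-B1 b∈B1
  ... | no _     | yes b∈B2 = sentToCv-B2 b∈B2
  ... | no b∉B1  | no b∉B2  = ≤-trans (≤-reflexive (sentToCv-other b∉B1 b∉B2)) z≤n

  Σ-sentToCv≡wF-Cv : sum (map sentToCv B) ≡ wF Cv
  Σ-sentToCv≡wF-Cv = begin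
    sum (map sentToCv B)        ≡⟨ sum-map-comm (recvFrom A) Cv B ⟨
    sum (map (received A B) Cv) ≡⟨ cong sum (map-cong-local (all-filter inC? Nv)) ⟩
    wF Cv                       ∎
    where open ≡-Reasoning

  wF-Nv≡wF-Cv+wF-N[v,A∖C] : wF Nv ≡ wF Cv + wF (N (v ∷ []) (AminusC A B))
  wF-Nv≡wF-Cv+wF-N[v,A∖C] =
    trans (sum-map-filter-split inC? w Nv) (cong (λ as → wF Cv + wF as) (filter-comm (∁? inC?) meetsV? A))

  N[X,A]⊑Nv : N X A ⊑ Nv
  N[X,A]⊑Nv = filter-⊑-filter _ meetsV? (All.tabulate meetsX⇒meetsV)
    where
    meetsX⇒meetsV : ∀ {a} → a ∈ A → Any (λ u → Meets u a) X → MeetsV a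
    meetsX⇒meetsV a∈A (here v-a)        = here v-a
    meetsX⇒meetsV {a} a∈A (there trim-a) with meetsV? a
    ... | yes a∈Nv = a∈Nv
    ... | no  a∉Nv with b , trim[b]-a ← satisfied (Any.map⁻ trim-a) =
      contradiction trim[b]-a (trim-avoids-Rv {b} (∈-filter⁺ (∁? meetsV?) a∈A a∉Nv))

  X-improves : wF (N (v ∷ []) (AminusC A B)) < w v → wF (N X A) < wF X
  X-improves small = begin-strict
    wF (N X A)                                ≤⟨ sum-map-⊑ w N[X,A]⊑Nv ⟩
    wF Nv                                     ≡⟨ wF-Nv≡wF-Cv+wF-N[v,A∖C] ⟩
    wF Cv + wF (N (v ∷ []) (AminusC A B))     <⟨ +-monoʳ-< (wF Cv) small ⟩
    wF Cv + w v                               ≡⟨ +-comm (wF Cv) (w v) ⟩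
    w v + wF Cv                               ≡⟨ cong (w v +_) Σ-sentToCv≡wF-Cv ⟨
    w v + sum (map sentToCv B)                ≡⟨ cong (w v +_) (sum-map-filter-pos sentToCv B) ⟨
    w v + sum (map sentToCv F)                ≤⟨ +-monoʳ-≤ (w v) (sum-map-≤ (All.universal sentToCv≤w-trim F)) ⟩
    w v + sum (map (w ∘ trim) F)              ≡⟨ cong (λ ws → w v + sum ws) (map-∘ F) ⟩
    wF X                                      ∎
    where open ≤-Reasoning

  length-Nv≤∣v∣ : AllPairs Disjoint A → length Nv ≤ ∣ v ∣
  length-Nv≤∣v∣ A-disj =
    ≤-trans (length-filter≤sum-map meetsV? (λ { (here v-a) → v-a }) A) (Σ∣p∩d∣≤∣p∣ A v A-disj)

  length-X≤1+2∣v∣ : AllPairs Disjoint A → All (λ a → ∣ a ∣ ≤ 3) A → length X ≤ 1 + 2 * ∣ v ∣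
  length-X≤1+2∣v∣ A-disj A-small = s≤s (begin
    length (map trim F)   ≡⟨ length-map trim F ⟩
    length F              ≤⟨ length-filter≤sum-map (λ b → 0 <? sentToCv b) id B ⟩
    sum (map sentToCv B)  ≡⟨ Σ-sentToCv≡wF-Cv ⟩
    wF Cv                 ≤⟨ sum-map-⊑ w (filter-⊆ inC? Nv) ⟩
    wF Nv                 ≤⟨ sum-map-≤-*length (All.filter⁺ meetsV? (All.map (∸-monoˡ-≤ 1) A-small)) ⟩
    2 * length Nv         ≤⟨ *-monoʳ-≤ 2 (length-Nv≤∣v∣ A-disj) ⟩
    2 * ∣ v ∣             ∎)
    where open ≤-Reasoning

  X-feasible : ∀ {S} → IsInstance S → Feasible S B → v ∈ B → sentToCv v ≡ 0 → Feasible S X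
  X-feasible {S} (S-members , S-hereditary) (B⊆S , _ , B-disj) v∈B sentToCv[v]≡0 =
    X⊆S , Disjoint-Nonempty⇒Unique X-nonempty X-disjoint , X-disjoint
    where
    ∈F⁻ : ∀ {b} → b ∈ F → b ∈ B × 0 < sentToCv b
    ∈F⁻ = ∈-filter⁻ (λ b → 0 <? sentToCv b)

    trim⊆ : ∀ b → trim b ⊆ b
    trim⊆ b = p─q⊆p b (⋃ Rv)

    trim-nonempty : ∀ {b} → b ∈ F → Nonempty (trim b)
    trim-nonempty {b} b∈F = 0<w⇒Nonempty (≤-trans (proj₂ (∈F⁻ b∈F)) (sentToCv≤w-trim b))

    v#trim : ∀ {b} → b ∈ F → Disjoint v (trim b)
    v#trim {b} b∈F with b∈B , pos ← ∈F⁻ b∈F =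
      Disjoint-mono id (trim⊆ b) (AllPairs⇒related Disjoint-sym B-disj v∈B b∈B v≢b)
      where
      v≢b : v ≢ b
      v≢b refl = <-irrefl (sym sentToCv[v]≡0) pos

    X⊆S : All (_∈ S) X
    X⊆S = All.lookup B⊆S v∈B ∷ All.map⁺ (All.tabulate λ {b} b∈F →
      S-hereditary b (trim b) (All.lookup B⊆S (proj₁ (∈F⁻ b∈F))) (trim-nonempty b∈F) (trim⊆ b))

    X-nonempty : All Nonempty X
    X-nonempty = proj₁ (All.lookup S-members (All.lookup B⊆S v∈B)) ∷ All.map⁺ (All.tabulate trim-nonempty)

    X-disjoint : AllPairs Disjoint X
    X-disjoint = All.map⁺ (All.tabulate v#trim) ∷
      AllPairs.map⁺ (AllPairs.map (Disjoint-mono (trim⊆ _) (trim⊆ _)) (AllPairs.filter⁺ _ B-disj))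

lemma3 : ∀ (n : ℕ) (S A B : List (Subset n)) →
    IsInstance S → Feasible S A → AllCard23 A → AllCard23 B →
    NoLocalImprovement S 10 A → Optimum S B →
    ∀ (v : Subset n) → v ∈ B → ¬ InB1 A v → ¬ InB2 A v →
    ¬ (wF (N (v ∷ []) (AminusC A B)) < w v)
lemma3 n S A B inst@(S-members , _) (A⊆S , _ , A-disj) _ _ no-improvement (B-feasible , _)
       v v∈B v∉B1 v∉B2 small =
  no-improvement X (X-feasible inst B-feasible v∈B (sentToCv-other v∉B1 v∉B2)) length-X≤10
                 (inj₁ (X-improves small))
  where
  open Exchange A B v
  size≤3 : ∀ {s} → s ∈ S → ∣ s ∣ ≤ 3
  size≤3 s∈S = proj₂ (All.lookup S-members s∈S)
  length-X≤10 : length X ≤ 10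
  length-X≤10 = ≤-trans (length-X≤1+2∣v∣ A-disj (All.map size≤3 A⊆S))
                        (s≤s (≤-trans (*-monoʳ-≤ 2 (size≤3 (All.lookup (proj₁ B-feasible) v∈B))) (m≤m+n 6 3)))
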